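{- For any $r\in\mathbb{N}$ and any class $\mathcal{F}$ of graphs, $\mathcal{F}$ has a $(0,r,\mathrm{wcol}_r(\mathcal{F}))$-disjunctive distance-$(r,r)$ labelling scheme.
   Context: For a graph $G$ with a total order $<$ on $V(G)$ and an integer $r\ge0$, a vertex $v$ is weakly $r$-reachable from $u$ if there is a path of length at most $r$ between $u$ and $v$ such that $v\le w$ for every vertex $w$ on the path. $\mathrm{wcol}_r(G)$ is the minimum $k$ such that some total order on $V(G)$ has, for every vertex $u$, at most $k$ vertices weakly $r$-reachable from $u$; $\mathrm{wcol}_r(\mathcal{F})=\sup_{G\in\mathcal{F}}\mathrm{wcol}_r(G)$. An $(s,t,k)$-disjunctive distance-$(r,r)$ labelling scheme for $\mathcal{F}$ deterministically assigns to each vertex $x$ of each $G\in\mathcal{F}$ (vertex set $[n]$) a label $[(p_1(x)\mid \vec q_1(x)),\dots,(p_t(x)\mid\vec q_t(x))]$ (at most $t$ pairs) where $p_i(x)$ are binary strings of total length at most $s$ and $\vec q_i(x)$ are vectors of natural numbers ("equality codes") with at most $k$ entries in total; the decoder, given the labels of $x$ and $y$, chooses (depending only on the prefixes and the structure of the labels) a set of pairs of equality-code positions and outputs $1$ iff some chosen pair of codes (one from $x$'s label, one from $y$'s) are equal. The output must be $1$ iff $\mathsf{dist}_G(x,y)\le r$, for all $G\in\mathcal{F}$ and $x,y\in V(G)$. -}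

module Defs where

open import Data.Nat using (ℕ; zero; suc; _+_; _≤_)
open import Data.Fin using (Fin; toℕ)
import Data.Fin as F
open import Data.Bool using (Bool; true; false)
open import Data.List using (List; []; _∷_; length; map)
open import Data.Nat.ListAction using (sum)
open import Data.List.Membership.Propositional using (_∈_)
open import Data.List.Relation.Unary.All using (All)
open import Data.List.Relation.Unary.Unique.Propositional using (Unique)
open import Data.Maybe using (Maybe; just; nothing)
open import Data.Product using (Σ; ∃; _×_; _,_; proj₁; proj₂)
open import Function.Definitions using (Injective)
open import Relation.Binary.PropositionalEquality using (_≡_)

record Graph (n : ℕ) : Set where
  field
    adj    : Fin n → Fin n → Bool
    sym    : ∀ x y → adj x y ≡ adj y x
    irrefl : ∀ x → adj x x ≡ false
open Graph public

GraphClass : Set₁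
GraphClass = (n : ℕ) → Graph n → Set

module _ {n : ℕ} (G : Graph n) where

  data Walk : Fin n → Fin n → Set where
    []  : ∀ {u} → Walk u u
    _∷_ : ∀ {u v w} → adj G u v ≡ true → Walk v w → Walk u w

  verts : ∀ {u v} → Walk u v → List (Fin n)
  verts ([] {u})      = u ∷ []
  verts (_∷_ {u} _ w) = u ∷ verts w

  len : ∀ {u v} → Walk u v → ℕ
  len []      = 0
  len (_ ∷ w) = suc (len w)

  IsPath : ∀ {u v} → Walk u v → Set
  IsPath w = Unique (verts w)

  Dist≤ : ℕ → Fin n → Fin n → Set
  Dist≤ r x y = Σ (Walk x y) λ w → IsPath w × len w ≤ r

-- Total orders on Fin n, represented by an injective rank function
-- (u ≤ v  iff  rank u ≤ rank v); every linear order on [n] arises this way.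

record Order (n : ℕ) : Set where
  field
    rank     : Fin n → Fin n
    rank-inj : Injective _≡_ _≡_ rank
open Order public

_≼[_]_ : ∀ {n} → Fin n → Order n → Fin n → Set
u ≼[ σ ] v = toℕ (rank σ u) ≤ toℕ (rank σ v)

WReach : ∀ {n} → Graph n → Order n → ℕ → Fin n → Fin n → Set
WReach G σ r u v =
  Σ (Walk G u v) λ w → IsPath G w × len G w ≤ r × All (λ x → v ≼[ σ ] x) (verts G w)

AtMost : ∀ {n} → ℕ → (Fin n → Set) → Set
AtMost {n} k P = Σ (List (Fin n)) λ L → length L ≤ k × (∀ v → P v → v ∈ L)

WcolAtMost : ∀ {n} → ℕ → Graph n → ℕ → Set
WcolAtMost {n} r G k = Σ (Order n) λ σ → ∀ u → AtMost k (WReach G σ r u)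

WcolClassAtMost : ℕ → GraphClass → ℕ → Set
WcolClassAtMost r F k = ∀ n (G : Graph n) → F n G → WcolAtMost r G k

-- A label: list of pairs (prefix p_i | equality codes q_i)
Label : Set
Label = List (List Bool × List ℕ)

-- the structure visible to the decoder: prefixes and the number of codes in each pair
Shape : Set
Shape = List (List Bool × ℕ)

shape : Label → Shape
shape = map (λ pq → proj₁ pq , length (proj₂ pq))

LabelBounded : ℕ → ℕ → ℕ → Label → Set
LabelBounded s t k ℓ =
  length ℓ ≤ t ×
  sum (map (λ pq → length (proj₁ pq)) ℓ) ≤ s ×
  sum (map (λ pq → length (proj₂ pq)) ℓ) ≤ k

nth : {A : Set} → List A → ℕ → Maybe A
nth []       _       = nothing
nth (x ∷ xs) zero    = just x
nth (x ∷ xs) (suc i) = nth xs i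

codeAt : Label → ℕ × ℕ → Maybe ℕ
codeAt ℓ (i , j) with nth ℓ i
... | nothing = nothing
... | just pq = nth (proj₂ pq) j

-- A decoder chooses, from the structure of the two labels, a set of
-- pairs of positions (one in x's label, one in y's label).
Decoder : Set
Decoder = Shape → Shape → ℕ × ℕ → ℕ × ℕ → Bool

Accepts : Decoder → Label → Label → Set
Accepts D ℓx ℓy =
  Σ (ℕ × ℕ) λ p → Σ (ℕ × ℕ) λ q →
    D (shape ℓx) (shape ℓy) p q ≡ true ×
    Σ ℕ λ c → codeAt ℓx p ≡ just c × codeAt ℓy q ≡ just c

record DisjunctiveScheme (F : GraphClass) (s t k r : ℕ) : Set where
  field
    decoder : Decoder
    encoder : (n : ℕ) (G : Graph n) → F n G → Fin n → Label
    bounded : ∀ n (G : Graph n) (g : F n G) x → LabelBounded s t k (encoder n G g x)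
    sound   : ∀ n (G : Graph n) (g : F n G) x y →
              Accepts decoder (encoder n G g x) (encoder n G g y) → Dist≤ G r x y
    complete : ∀ n (G : Graph n) (g : F n G) x y →
              Dist≤ G r x y → Accepts decoder (encoder n G g x) (encoder n G g y)

{-# OPTIONS --safe #-}
-- Fix an order witnessing wcol_r ≤ k and, for each vertex x, the list L_x ⊇ WReach_r[x]
-- of size ≤ k.  The level of z ∈ L_x is the least a ≤ r such that x reaches z by a walk
-- of length ≤ a through vertices ≥ z only.  A walk of length ≤ r from x to y splits at
-- its minimum vertex z into two such walks, so z lies in L_x ∩ L_y with levels summing
-- to ≤ r; conversely two such walks ending in the same z glue to a walk from x to y.
-- The label of x lists the vertex numbers of L_x grouped by level, one pair per level,
-- except that x itself (the only vertex of level 0) heads the pair of level 1; the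
-- decoder compares two codes iff their levels sum to at most r.
module Submission where

open import Defs hiding (sym)
open import Data.Nat using (ℕ; zero; suc; _+_; _≤_; _<_; z≤n; s≤s; s≤s⁻¹; _≤ᵇ_; _≤?_; _≟_)
open import Data.Nat.Properties
  using (≤-refl; ≤-reflexive; ≤-trans; ≰⇒≥; m≤n⇒m≤1+n; m≤n+m; <⇒≢; m<n⇒m<1+n; n≤0⇒n≡0;
         ≤ᵇ⇒≤; ≤⇒≤ᵇ; m+n≤o⇒m≤o; m+n≤o⇒n≤o; +-mono-≤; +-monoˡ-≤; +-monoʳ-≤; +-suc; +-identityʳ; module ≤-Reasoning)
open import Data.Fin using (Fin; toℕ)
open import Data.Fin.Properties using (toℕ-injective; any?) renaming (_≟_ to _≟ᶠ_)
open import Data.Bool using (true)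
open import Data.Bool.Properties using (T-≡) renaming (_≟_ to _≟ᵇ_)
open import Data.List using (List; []; _∷_; length; map; filter)
open import Data.List.Properties using (length-map; filter-accept; filter-reject; filter-some)
open import Data.Nat.ListAction using (sum)
open import Data.List.Membership.Propositional using (_∈_)
open import Data.List.Membership.Propositional.Properties using (∈-map∘filter⁺; ∈-map∘filter⁻)
import Data.List.Membership.DecPropositional as DecMembership
open import Data.List.Relation.Binary.Subset.Propositional using (_⊆_)
open import Data.List.Relation.Unary.Any using (here; there)
import Data.List.Relation.Unary.Any as Any
open import Data.List.Relation.Unary.All using (All; []; _∷_)
import Data.List.Relation.Unary.All as All
open import Data.List.Relation.Unary.All.Properties using (anti-mono; ¬Any⇒All¬)
open import Data.List.Relation.Unary.AllPairs using ([]; _∷_)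
open import Data.Maybe using (just; nothing)
open import Data.Product using (Σ; ∃-syntax; _×_; _,_; proj₁; proj₂)
open import Function using (_∘_)
open import Function.Bundles using (Equivalence)
open import Relation.Binary.PropositionalEquality using (_≡_; refl; sym; trans; cong; cong₂; subst; subst₂)
open import Relation.Nullary using (Dec; yes; no; contradiction)
open import Relation.Nullary.Decidable using (_×-dec_)
open import Relation.Unary using (Decidable)

-- The least i < b with P i, or b if there is none.
least : ∀ {p} {P : ℕ → Set p} → Decidable P → ℕ → ℕ
least P? zero    = zero
least P? (suc b) with P? zero
... | yes _ = zero
... | no  _ = suc (least (P? ∘ suc) b)

least-satisfies : ∀ {p} {P : ℕ → Set p} (P? : Decidable P) b → least P? b < b → P (least P? b)
least-satisfies P? (suc b) lt with P? zero
... | yes P0 = P0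
... | no  _  = least-satisfies (P? ∘ suc) b (s≤s⁻¹ lt)

least-minimal : ∀ {p} {P : ℕ → Set p} (P? : Decidable P) b {i} → P i → least P? b ≤ i
least-minimal P? zero    Pi = z≤n
least-minimal P? (suc b) {i} Pi with P? zero | i
... | yes _  | _     = z≤n
... | no ¬P0 | zero  = contradiction Pi ¬P0
... | no _   | suc i = s≤s (least-minimal (P? ∘ suc) b Pi)

module _ {a} {A : Set a} (f : A → ℕ) where

  atLevel : ℕ → List A → List A
  atLevel l = filter (λ x → f x ≟ l)

  countLevels : ℕ → ℕ → List A → ℕ
  countLevels l zero    xs = 0
  countLevels l (suc m) xs = length (atLevel l xs) + countLevels (suc l) m xs

  countLevels-[] : ∀ l m → countLevels l m [] ≡ 0
  countLevels-[] l zero    = refl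
  countLevels-[] l (suc m) = countLevels-[] (suc l) m

  countLevels-below : ∀ l m {x} xs → f x < l → countLevels l m (x ∷ xs) ≡ countLevels l m xs
  countLevels-below l zero    xs fx<l = refl
  countLevels-below l (suc m) xs fx<l =
    cong₂ (λ ys c → length ys + c)
      (filter-reject (λ x → f x ≟ l) (<⇒≢ fx<l))
      (countLevels-below (suc l) m xs (m<n⇒m<1+n fx<l))

  countLevels-∷ : ∀ l m x xs → countLevels l m (x ∷ xs) ≤ suc (countLevels l m xs)
  countLevels-∷ l zero    x xs = z≤n
  countLevels-∷ l (suc m) x xs with f x ≟ l
  ... | yes fx≡l = ≤-reflexive (cong₂ (λ ys c → length ys + c)
                     (filter-accept (λ x → f x ≟ l) fx≡l)
                     (countLevels-below (suc l) m xs (s≤s (≤-reflexive fx≡l))))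
  ... | no fx≢l = begin
    length (atLevel l (x ∷ xs)) + countLevels (suc l) m (x ∷ xs)
      ≡⟨ cong (λ ys → length ys + countLevels (suc l) m (x ∷ xs)) (filter-reject (λ x → f x ≟ l) fx≢l) ⟩
    length (atLevel l xs) + countLevels (suc l) m (x ∷ xs)
      ≤⟨ +-monoʳ-≤ (length (atLevel l xs)) (countLevels-∷ (suc l) m x xs) ⟩
    length (atLevel l xs) + suc (countLevels (suc l) m xs)
      ≡⟨ +-suc (length (atLevel l xs)) (countLevels (suc l) m xs) ⟩
    suc (countLevels l (suc m) xs) ∎
    where open ≤-Reasoning

  countLevels≤length : ∀ l m xs → countLevels l m xs ≤ length xs
  countLevels≤length l m []       = ≤-reflexive (countLevels-[] l m)
  countLevels≤length l m (x ∷ xs) = ≤-trans (countLevels-∷ l m x xs) (s≤s (countLevels≤length l m xs))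

nth⇒∈ : ∀ {A : Set} (xs : List A) j {c} → nth xs j ≡ just c → c ∈ xs
nth⇒∈ (x ∷ xs) zero    refl = here refl
nth⇒∈ (x ∷ xs) (suc j) eq   = there (nth⇒∈ xs j eq)

∈⇒nth : ∀ {A : Set} {xs : List A} {c} → c ∈ xs → ∃[ j ] nth xs j ≡ just c
∈⇒nth (here refl) = zero , refl
∈⇒nth (there c∈)  with ∈⇒nth c∈
... | j , eq = suc j , eq

codeAt-suc : ∀ pq ℓ i j → codeAt (pq ∷ ℓ) (suc i , j) ≡ codeAt ℓ (i , j)
codeAt-suc pq ℓ i j with nth ℓ i
... | just _ = refl
... | nothing = refl

module _ {n : ℕ} (G : Graph n) where

  open DecMembership (_≟ᶠ_ {n}) using (_∈?_)

  suffixFrom : ∀ {a b u} (w : Walk G a b) → u ∈ verts G w →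
               Σ (Walk G u b) λ q → len G q ≤ len G w × verts G q ⊆ verts G w × (IsPath G w → IsPath G q)
  suffixFrom []      (here refl) = [] , z≤n , (λ v∈ → v∈) , (λ p → p)
  suffixFrom (e ∷ w) (here refl) = e ∷ w , ≤-refl , (λ v∈ → v∈) , (λ p → p)
  suffixFrom (e ∷ w) (there u∈) with suffixFrom w u∈
  ... | q , q≤w , q⊆w , path⇒path = q , m≤n⇒m≤1+n q≤w , there ∘ q⊆w , λ { (_ ∷ pw) → path⇒path pw }

  walk⇒path : ∀ {a b} (w : Walk G a b) → Σ (Walk G a b) λ p → IsPath G p × len G p ≤ len G w × verts G p ⊆ verts G w
  walk⇒path []      = [] , [] ∷ [] , z≤n , (λ v∈ → v∈)
  walk⇒path (_∷_ {u} e w) with walk⇒path w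
  ... | p , path , p≤w , p⊆w with u ∈? verts G p
  ...   | yes u∈p with suffixFrom p u∈p
  ...     | q , q≤p , q⊆p , path⇒path = q , path⇒path path , m≤n⇒m≤1+n (≤-trans q≤p p≤w) , there ∘ p⊆w ∘ q⊆p
  walk⇒path (_∷_ {u} e w) | p , path , p≤w , p⊆w | no u∉p =
    e ∷ p , ¬Any⇒All¬ _ u∉p ∷ path , s≤s p≤w , λ { (here eq) → here eq ; (there v∈) → there (p⊆w v∈) }

module _ {n : ℕ} (G : Graph n) (σ : Order n) where

  private
    _≼_ : Fin n → Fin n → Set
    u ≼ v = u ≼[ σ ] v

    _≼?_ : ∀ u v → Dec (u ≼ v)
    u ≼? v = toℕ (rank σ u) ≤? toℕ (rank σ v)

  -- Walks of length at most i (not exactly i) in the subgraph induced by the vertices ≽ m.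
  data WalkAbove (m : Fin n) : ℕ → Fin n → Fin n → Set where
    stop : ∀ {i x} → m ≼ x → WalkAbove m i x x
    step : ∀ {i x y z} → m ≼ x → adj G x y ≡ true → WalkAbove m i y z → WalkAbove m (suc i) x z

  WalkAbove-head : ∀ {m i x z} → WalkAbove m i x z → m ≼ x
  WalkAbove-head (stop m≼x)     = m≼x
  WalkAbove-head (step m≼x _ _) = m≼x

  WalkAbove-zero : ∀ {m x z} → WalkAbove m 0 x z → x ≡ z
  WalkAbove-zero (stop _) = refl

  WalkAbove-weaken : ∀ {m i j x z} → i ≤ j → WalkAbove m i x z → WalkAbove m j x z
  WalkAbove-weaken _         (stop m≼x)     = stop m≼x
  WalkAbove-weaken (s≤s i≤j) (step m≼x e w) = step m≼x e (WalkAbove-weaken i≤j w)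

  WalkAbove-++ : ∀ {m i j x y z} → WalkAbove m i x y → WalkAbove m j y z → WalkAbove m (i + j) x z
  WalkAbove-++ {i = i} {j} (stop _) w′ = WalkAbove-weaken (m≤n+m j i) w′
  WalkAbove-++ (step m≼x e w) w′ = step m≼x e (WalkAbove-++ w w′)

  WalkAbove-snoc : ∀ {m i x y z} → WalkAbove m i x y → adj G y z ≡ true → m ≼ z → WalkAbove m (suc i) x z
  WalkAbove-snoc (stop m≼x)      e m≼z = step m≼x e (stop m≼z)
  WalkAbove-snoc (step m≼x e′ w) e m≼z = step m≼x e′ (WalkAbove-snoc w e m≼z)

  WalkAbove-reverse : ∀ {m i x z} → WalkAbove m i x z → WalkAbove m i z x
  WalkAbove-reverse (stop m≼x) = stop m≼x
  WalkAbove-reverse {x = x} (step {y = y} m≼x e w) =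
    WalkAbove-snoc (WalkAbove-reverse w) (trans (Graph.sym G y x) e) m≼x

  Walk⇒WalkAbove : ∀ {m x z} (w : Walk G x z) → All (m ≼_) (verts G w) → WalkAbove m (len G w) x z
  Walk⇒WalkAbove []      (m≼x ∷ [])  = stop m≼x
  Walk⇒WalkAbove (e ∷ w) (m≼x ∷ m≼w) = step m≼x e (Walk⇒WalkAbove w m≼w)

  WalkAbove⇒Walk : ∀ {m i x z} → WalkAbove m i x z → Σ (Walk G x z) λ w → len G w ≤ i × All (m ≼_) (verts G w)
  WalkAbove⇒Walk (stop m≼x)     = [] , z≤n , m≼x ∷ []
  WalkAbove⇒Walk (step m≼x e w) with WalkAbove⇒Walk w
  ... | w′ , w′≤i , m≼w′ = e ∷ w′ , s≤s w′≤i , m≼x ∷ m≼w′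

  WalkAbove⇒path : ∀ {m i x z} → WalkAbove m i x z →
                   Σ (Walk G x z) λ p → IsPath G p × len G p ≤ i × All (m ≼_) (verts G p)
  WalkAbove⇒path w with WalkAbove⇒Walk w
  ... | w′ , w′≤i , m≼w′ with walk⇒path G w′
  ...   | p , path , p≤w′ , p⊆w′ = p , path , ≤-trans p≤w′ w′≤i , anti-mono p⊆w′ m≼w′

  WalkAbove⇒WReach : ∀ {z a x R} → WalkAbove z a x z → a ≤ R → WReach G σ R x z
  WalkAbove⇒WReach w a≤R with WalkAbove⇒path w
  ... | p , path , p≤a , z≼p = p , path , ≤-trans p≤a a≤R , z≼p

  WalkAbove⇒Dist≤ : ∀ {m i x z R} → WalkAbove m i x z → i ≤ R → Dist≤ G R x z
  WalkAbove⇒Dist≤ w i≤R with WalkAbove⇒path w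
  ... | p , path , p≤i , _ = p , path , ≤-trans p≤i i≤R

  walkAbove? : ∀ m i x z → Dec (WalkAbove m i x z)
  walkAbove? m i x z with m ≼? x | x ≟ᶠ z
  ... | no m⋠x | _        = no (m⋠x ∘ WalkAbove-head)
  ... | yes m≼x | yes refl = yes (stop m≼x)
  walkAbove? m zero    x z | yes _ | no x≢z = no (x≢z ∘ WalkAbove-zero)
  walkAbove? m (suc i) x z | yes m≼x | no x≢z with any? (λ y → (adj G x y ≟ᵇ true) ×-dec walkAbove? m i y z)
  ... | yes (y , e , w) = yes (step m≼x e w)
  ... | no ∄y           = no λ { (stop _) → x≢z refl ; (step _ e w) → ∄y (_ , e , w) }

  splitAtMinimum : ∀ {x y} (w : Walk G x y) →
    ∃[ z ] ∃[ a ] ∃[ b ] a + b ≤ len G w × WalkAbove z a x z × WalkAbove z b y z × All (z ≼_) (verts G w)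
  splitAtMinimum {x} [] = x , 0 , 0 , z≤n , stop ≤-refl , stop ≤-refl , ≤-refl ∷ []
  splitAtMinimum {x} (e ∷ w) with splitAtMinimum w
  ... | z , a , b , a+b≤w , wa , wb , z≼w with z ≼? x
  ...   | yes z≼x = z , suc a , b , s≤s a+b≤w , step z≼x e wa , wb , z≼x ∷ z≼w
  ...   | no z⋠x  = x , 0 , suc (len G w) , ≤-refl , stop ≤-refl , WalkAbove-reverse (Walk⇒WalkAbove (e ∷ w) x≼ew) , x≼ew
    where
    x≼ew : All (x ≼_) (verts G (e ∷ w))
    x≼ew = ≤-refl ∷ All.map (≤-trans (≰⇒≥ z⋠x)) z≼w

  WReach-refl : ∀ {R x} → WReach G σ R x x
  WReach-refl = [] , [] ∷ [] , z≤n , ≤-refl ∷ []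

-- Position (0 , 0) holds x itself, the other codes of pair 0 have level 1, and the codes of
-- pair i + 1 have level i + 2.
positionLevel : ℕ × ℕ → ℕ
positionLevel (zero  , zero)  = 0
positionLevel (zero  , suc _) = 1
positionLevel (suc i , _)     = suc (suc i)

levelDecoder : ℕ → Decoder
levelDecoder r _ _ p q = positionLevel p + positionLevel q ≤ᵇ r

module _ {n : ℕ} (G : Graph n) (σ : Order n) (r′ : ℕ) where

  private
    r : ℕ
    r = suc r′

  level : Fin n → Fin n → ℕ
  level x z = least (λ i → walkAbove? G σ z i x z) (suc r)

  level-walkAbove : ∀ {x z} → level x z ≤ r → WalkAbove G σ z (level x z) x z
  level-walkAbove {x} {z} l≤r = least-satisfies (λ i → walkAbove? G σ z i x z) (suc r) (s≤s l≤r)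

  level-minimal : ∀ {x z a} → WalkAbove G σ z a x z → level x z ≤ a
  level-minimal {x} {z} = least-minimal (λ i → walkAbove? G σ z i x z) (suc r)

  level≡0⇒≡ : ∀ {x z} → level x z ≡ 0 → z ≡ x
  level≡0⇒≡ {x} {z} l≡0 =
    sym (WalkAbove-zero G σ (subst (λ i → WalkAbove G σ z i x z) l≡0 (level-walkAbove (≤-trans (≤-reflexive l≡0) z≤n))))

  level-self : ∀ x → level x x ≡ 0
  level-self x = n≤0⇒n≡0 (level-minimal (stop ≤-refl))

  codes : Fin n → List (Fin n) → ℕ → List ℕ
  codes x L l = map toℕ (atLevel (level x) l L)

  levelPairs : Fin n → List (Fin n) → ℕ → ℕ → Label
  levelPairs x L l zero    = []
  levelPairs x L l (suc m) = ([] , codes x L l) ∷ levelPairs x L (suc l) m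

  label : Fin n → List (Fin n) → Label
  label x L = ([] , toℕ x ∷ codes x L 1) ∷ levelPairs x L 2 r′

  ∈codes⁺ : ∀ {x L l z} → z ∈ L → level x z ≡ l → toℕ z ∈ codes x L l
  ∈codes⁺ {x} {L} {l} {z} z∈L lz≡l = ∈-map∘filter⁺ toℕ (λ z → level x z ≟ l) (z , z∈L , refl , lz≡l)

  ∈codes⇒WalkAbove : ∀ x L l {c} → c ∈ codes x L l → l ≤ r → ∃[ z ] c ≡ toℕ z × WalkAbove G σ z l x z
  ∈codes⇒WalkAbove x L l c∈ l≤r with ∈-map∘filter⁻ toℕ (λ z → level x z ≟ l) {xs = L} c∈
  ... | z , _ , c≡z , refl = z , c≡z , level-walkAbove l≤r

  codeAt-levelPairs⁻ : ∀ x L l m i j {c} → codeAt (levelPairs x L l m) (i , j) ≡ just c →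
                       i < m × c ∈ codes x L (l + i)
  codeAt-levelPairs⁻ x L l zero i j ()
  codeAt-levelPairs⁻ x L l (suc m) zero j {c} eq =
    s≤s z≤n , subst (λ l′ → c ∈ codes x L l′) (sym (+-identityʳ l)) (nth⇒∈ _ j eq)
  codeAt-levelPairs⁻ x L l (suc m) (suc i) j {c} eq
    with codeAt-levelPairs⁻ x L (suc l) m i j (trans (sym (codeAt-suc ([] , codes x L l) (levelPairs x L (suc l) m) i j)) eq)
  ... | i<m , c∈ = s≤s i<m , subst (λ l′ → c ∈ codes x L l′) (sym (+-suc l i)) c∈

  codeAt-levelPairs⁺ : ∀ x L l m i {c} → i < m → c ∈ codes x L (l + i) →
                       ∃[ j ] codeAt (levelPairs x L l m) (i , j) ≡ just c
  codeAt-levelPairs⁺ x L l (suc m) zero {c} _ c∈ = ∈⇒nth (subst (λ l′ → c ∈ codes x L l′) (+-identityʳ l) c∈)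
  codeAt-levelPairs⁺ x L l (suc m) (suc i) {c} (s≤s i<m) c∈
    with codeAt-levelPairs⁺ x L (suc l) m i i<m (subst (λ l′ → c ∈ codes x L l′) (+-suc l i) c∈)
  ... | j , eq = j , trans (codeAt-suc ([] , codes x L l) (levelPairs x L (suc l) m) i j) eq

  label-sound : ∀ x L p {c} → codeAt (label x L) p ≡ just c →
                ∃[ z ] c ≡ toℕ z × WalkAbove G σ z (positionLevel p) x z
  label-sound x L (zero , zero)  refl = x , refl , stop ≤-refl
  label-sound x L (zero , suc j) eq   = ∈codes⇒WalkAbove x L 1 (nth⇒∈ (codes x L 1) j eq) (s≤s z≤n)
  label-sound x L (suc i , j)    eq
    with codeAt-levelPairs⁻ x L 2 r′ i j (trans (sym (codeAt-suc ([] , toℕ x ∷ codes x L 1) (levelPairs x L 2 r′) i j)) eq)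
  ... | i<r′ , c∈ = ∈codes⇒WalkAbove x L (2 + i) c∈ (s≤s i<r′)

  label-complete : ∀ {x L z} l → z ∈ L → level x z ≡ l → l ≤ r →
                   ∃[ p ] positionLevel p ≡ l × codeAt (label x L) p ≡ just (toℕ z)
  label-complete zero z∈L lz≡0 _ = (zero , zero) , refl , cong (just ∘ toℕ) (sym (level≡0⇒≡ lz≡0))
  label-complete (suc zero) z∈L lz≡1 _ with ∈⇒nth (∈codes⁺ z∈L lz≡1)
  ... | j , eq = (zero , suc j) , refl , eq
  label-complete {x} {L} (suc (suc i)) z∈L lz≡l l≤r
    with codeAt-levelPairs⁺ x L 2 r′ i (s≤s⁻¹ l≤r) (∈codes⁺ z∈L lz≡l)
  ... | j , eq = (suc i , j) , refl , trans (codeAt-suc ([] , toℕ x ∷ codes x L 1) (levelPairs x L 2 r′) i j) eq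

  length-levelPairs : ∀ x L l m → length (levelPairs x L l m) ≡ m
  length-levelPairs x L l zero    = refl
  length-levelPairs x L l (suc m) = cong suc (length-levelPairs x L (suc l) m)

  prefixLength-levelPairs : ∀ x L l m → sum (map (λ pq → length (proj₁ pq)) (levelPairs x L l m)) ≡ 0
  prefixLength-levelPairs x L l zero    = refl
  prefixLength-levelPairs x L l (suc m) = prefixLength-levelPairs x L (suc l) m

  codeCount-levelPairs : ∀ x L l m →
    sum (map (λ pq → length (proj₂ pq)) (levelPairs x L l m)) ≡ countLevels (level x) l m L
  codeCount-levelPairs x L l zero    = refl
  codeCount-levelPairs x L l (suc m) =
    cong₂ _+_ (length-map toℕ (atLevel (level x) l L)) (codeCount-levelPairs x L (suc l) m)

  label-bounded : ∀ {x L k} → x ∈ L → length L ≤ k → LabelBounded 0 r k (label x L)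
  label-bounded {x} {L} {k} x∈L L≤k =
    s≤s (≤-reflexive (length-levelPairs x L 2 r′)) , ≤-reflexive (prefixLength-levelPairs x L 2 r′) , codeCount≤k
    where
    -- The extra code toℕ x in pair 0 is paid for by x's own entry in L, which has level 0.
    x-atLevel0 : 0 < length (atLevel (level x) 0 L)
    x-atLevel0 = filter-some (λ z → level x z ≟ 0) (Any.map (λ { refl → level-self x }) x∈L)

    codeCount≤k : sum (map (λ pq → length (proj₂ pq)) (label x L)) ≤ k
    codeCount≤k = begin
      suc (length (codes x L 1)) + sum (map (λ pq → length (proj₂ pq)) (levelPairs x L 2 r′))
        ≡⟨ cong₂ (λ a b → suc a + b) (length-map toℕ (atLevel (level x) 1 L)) (codeCount-levelPairs x L 2 r′) ⟩
      suc (countLevels (level x) 1 r L)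
        ≤⟨ +-monoˡ-≤ (countLevels (level x) 1 r L) x-atLevel0 ⟩
      countLevels (level x) 0 (suc r) L
        ≤⟨ countLevels≤length (level x) 0 (suc r) L ⟩
      length L
        ≤⟨ L≤k ⟩
      k ∎
      where open ≤-Reasoning

  accepts⇒Dist≤ : ∀ {x y} Lx Ly → Accepts (levelDecoder r) (label x Lx) (label y Ly) → Dist≤ G r x y
  accepts⇒Dist≤ {x} {y} Lx Ly (p , q , chosen , c , ex , ey) with label-sound x Lx p ex | label-sound y Ly q ey
  ... | z , refl , wx | z′ , z≡z′ , wy with toℕ-injective z≡z′
  ... | refl = WalkAbove⇒Dist≤ G σ (WalkAbove-++ G σ wx (WalkAbove-reverse G σ wy))
                 (≤ᵇ⇒≤ (positionLevel p + positionLevel q) r (Equivalence.from T-≡ chosen))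

  sharedMinimum⇒accepts : ∀ {x y z} Lx Ly → z ∈ Lx → z ∈ Ly → level x z + level y z ≤ r →
                          Accepts (levelDecoder r) (label x Lx) (label y Ly)
  sharedMinimum⇒accepts {x} {y} {z} Lx Ly z∈Lx z∈Ly levels≤r
    with label-complete (level x z) z∈Lx refl (m+n≤o⇒m≤o (level x z) levels≤r)
       | label-complete (level y z) z∈Ly refl (m+n≤o⇒n≤o (level x z) levels≤r)
  ... | p , p≡ , ep | q , q≡ , eq =
    p , q , Equivalence.to T-≡ (≤⇒≤ᵇ (subst₂ (λ u v → u + v ≤ r) (sym p≡) (sym q≡) levels≤r)) , toℕ z , ep , eq

  Dist≤⇒accepts : ∀ {x y} Lx Ly → (∀ z → WReach G σ r x z → z ∈ Lx) → (∀ z → WReach G σ r y z → z ∈ Ly) →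
                  Dist≤ G r x y → Accepts (levelDecoder r) (label x Lx) (label y Ly)
  Dist≤⇒accepts Lx Ly reach-x reach-y (w , _ , w≤r) with splitAtMinimum G σ w
  ... | z , a , b , a+b≤w , wa , wb , _ =
    sharedMinimum⇒accepts Lx Ly (reach-x z (WalkAbove⇒WReach G σ wa a≤r)) (reach-y z (WalkAbove⇒WReach G σ wb b≤r))
      (≤-trans (+-mono-≤ (level-minimal wa) (level-minimal wb)) a+b≤r)
    where
    a+b≤r : a + b ≤ r
    a+b≤r = ≤-trans a+b≤w w≤r
    a≤r : a ≤ r
    a≤r = m+n≤o⇒m≤o a a+b≤r
    b≤r : b ≤ r
    b≤r = m+n≤o⇒n≤o a a+b≤r

theorem4p14 : (r : ℕ) (F : GraphClass) (k : ℕ) → 1 ≤ r →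
    WcolClassAtMost r F k → DisjunctiveScheme F 0 r k r
theorem4p14 (suc r′) F k (s≤s z≤n) wcol = record
  { decoder  = levelDecoder (suc r′)
  ; encoder  = λ n G g x → label G (order G g) r′ x (reach G g x)
  ; bounded  = λ n G g x → label-bounded G (order G g) r′ (reach-complete G g x x (WReach-refl G (order G g)))
                                                           (reach-length G g x)
  ; sound    = λ n G g x y → accepts⇒Dist≤ G (order G g) r′ (reach G g x) (reach G g y)
  ; complete = λ n G g x y → Dist≤⇒accepts G (order G g) r′ (reach G g x) (reach G g y)
                                              (reach-complete G g x) (reach-complete G g y)
  }
  where
  order : ∀ {n} (G : Graph n) → F n G → Order n
  order G g = proj₁ (wcol _ G g)

  reach : ∀ {n} (G : Graph n) → F n G → Fin n → List (Fin n)
  reach G g x = proj₁ (proj₂ (wcol _ G g) x)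

  reach-length : ∀ {n} (G : Graph n) (g : F n G) x → length (reach G g x) ≤ k
  reach-length G g x = proj₁ (proj₂ (proj₂ (wcol _ G g) x))

  reach-complete : ∀ {n} (G : Graph n) (g : F n G) x z → WReach G (order G g) (suc r′) x z → z ∈ reach G g x
  reach-complete G g x = proj₂ (proj₂ (proj₂ (wcol _ G g) x))
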